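{- Let $R$ be a commutative ring, $n\in\mathbb{Z}_{>0}$ and $A,B\in\mathrm{Mat}_n(R)$. Then $A$ and $B$ are similar over $R$ if and only if (a) the $C_R(B)$-module $C_R(A,B)$ is free of rank $1$, and (b) every (equivalently, any) free generator $C$ of $C_R(A,B)$ over $C_R(B)$ lies in $\mathrm{GL}_n(R)$. Furthermore, when this is the case, any $C$ as in (b) satisfies $B=CAC^{ -1}$.
   Context: $A,B$ are similar over $R$ if $B=CAC^{ -1}$ for some $C\in\mathrm{GL}_n(R)$. $C_R(A,B)=\{X\in\mathrm{Mat}_n(R):XA=BX\}$ and $C_R(B)=C_R(B,B)$; $C_R(B)$ is an $R$-algebra and $C_R(A,B)$ is a left $C_R(B)$-module by left multiplication. -}

module Defs where

open import Level using (_⊔_)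
open import Data.Nat using (ℕ)
open import Data.Fin using (Fin; _≟_)
open import Data.Product using (Σ; _×_; ∃)
open import Relation.Nullary using (does)
open import Data.Bool using (if_then_else_)
open import Algebra.Bundles using (CommutativeRing)
import Algebra.Definitions.RawMonoid as RawMonoidDefs

module MatrixDefs {c ℓ} (R : CommutativeRing c ℓ) where
  open CommutativeRing R
  open RawMonoidDefs +-rawMonoid using (sum)

  Mat : ℕ → Set c
  Mat n = Fin n → Fin n → Carrier

  _≈ᴹ_ : ∀ {n} → Mat n → Mat n → Set ℓ
  X ≈ᴹ Y = ∀ i j → X i j ≈ Y i j
  infix 4 _≈ᴹ_

  _*ᴹ_ : ∀ {n} → Mat n → Mat n → Mat n
  (X *ᴹ Y) i j = sum (λ k → X i k * Y k j)
  infixl 7 _*ᴹ_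

  Iᴹ : ∀ {n} → Mat n
  Iᴹ i j = if does (i ≟ j) then 1# else 0#

  IsInverse : ∀ {n} → Mat n → Mat n → Set ℓ
  IsInverse C D = (C *ᴹ D ≈ᴹ Iᴹ) × (D *ᴹ C ≈ᴹ Iᴹ)

  InGL : ∀ {n} → Mat n → Set (c ⊔ ℓ)
  InGL C = ∃ λ D → IsInverse C D

  Similar : ∀ {n} → Mat n → Mat n → Set (c ⊔ ℓ)
  Similar A B = ∃ λ C → ∃ λ D → IsInverse C D × (B ≈ᴹ C *ᴹ A *ᴹ D)

  InC : ∀ {n} → Mat n → Mat n → Mat n → Set ℓ
  InC A B X = X *ᴹ A ≈ᴹ B *ᴹ X

  -- C is a free generator of the left C_R(B)-module C_R(A,B):
  -- C ∈ C_R(A,B) and Y ↦ Y C is a bijection C_R(B) → C_R(A,B)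
  IsFreeGenerator : ∀ {n} → Mat n → Mat n → Mat n → Set (c ⊔ ℓ)
  IsFreeGenerator A B C =
    InC A B C
    × (∀ X → InC A B X → ∃ λ Y → InC B B Y × (X ≈ᴹ Y *ᴹ C))
    × (∀ Y Y′ → InC B B Y → InC B B Y′ → Y *ᴹ C ≈ᴹ Y′ *ᴹ C → Y ≈ᴹ Y′)

  FreeRank1 : ∀ {n} → Mat n → Mat n → Set (c ⊔ ℓ)
  FreeRank1 A B = ∃ λ C → IsFreeGenerator A B C

{-# OPTIONS --safe #-}

-- The whole argument takes place in the multiplicative monoid of n×n matrices and
-- works verbatim in any monoid. If P A P⁻¹ = B, then X ↦ X P⁻¹ identifies C(A,B)
-- with C(B), so P is a free generator. Two free generators C and P satisfy C = U P
-- and P = V C with U, V ∈ C(B), and injectivity of Y ↦ Y C, Y ↦ Y P forces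
-- U V = V U = 1; hence every free generator is invertible as soon as one is.
-- Conversely, an invertible element C of C(A,B) gives B = C A C⁻¹ directly.
module Submission where

open import Defs
open import Level using (Level; _⊔_)
open import Data.Nat using (ℕ; _<_)
open import Data.Fin using (Fin; zero; suc)
open import Data.Product using (_×_; _,_; proj₁; ∃)
open import Function.Bundles using (_⇔_; mk⇔)
open import Algebra.Bundles using (Monoid; CommutativeRing)
import Algebra.Properties.Monoid as MonoidProperties
import Algebra.Properties.Semiring.Sum as SemiringSum
import Relation.Binary.Reasoning.Setoid as SetoidReasoning

module Intertwining {m ℓ} (M : Monoid m ℓ) where
  open Monoid M
  open MonoidProperties M using (cancelˡ; cancelʳ; cancelᶜ; insertʳ)
  open SetoidReasoning setoid

  InC : Carrier → Carrier → Carrier → Set ℓ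
  InC a b x = x ∙ a ≈ b ∙ x

  IsInverse : Carrier → Carrier → Set ℓ
  IsInverse x y = (x ∙ y ≈ ε) × (y ∙ x ≈ ε)

  InGL : Carrier → Set (m ⊔ ℓ)
  InGL x = ∃ λ y → IsInverse x y

  Similar : Carrier → Carrier → Set (m ⊔ ℓ)
  Similar a b = ∃ λ p → ∃ λ q → IsInverse p q × (b ≈ p ∙ a ∙ q)

  IsFreeGenerator : Carrier → Carrier → Carrier → Set (m ⊔ ℓ)
  IsFreeGenerator a b c =
    InC a b c
    × (∀ x → InC a b x → ∃ λ y → InC b b y × (x ≈ y ∙ c))
    × (∀ y y′ → InC b b y → InC b b y′ → y ∙ c ≈ y′ ∙ c → y ≈ y′)

  FreeRank1 : Carrier → Carrier → Set (m ⊔ ℓ)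
  FreeRank1 a b = ∃ λ c → IsFreeGenerator a b c

  private
    variable
      a b c c′ p q u v x y : Carrier

  IsInverse-respˡ : x ≈ y → IsInverse x q → IsInverse y q
  IsInverse-respˡ x≈y (xq , qx) = trans (∙-congʳ (sym x≈y)) xq , trans (∙-congˡ (sym x≈y)) qx

  IsInverse-∙ : IsInverse u v → IsInverse p q → IsInverse (u ∙ p) (q ∙ v)
  IsInverse-∙ {u} {v} {p} {q} (uv , vu) (pq , qp) = trans (cancelᶜ pq u v) uv , trans (cancelᶜ vu q p) qp

  InC-ε : InC a a ε
  InC-ε {a} = trans (identityˡ a) (sym (identityʳ a))

  InC-∙ : InC b c x → InC a b y → InC a c (x ∙ y)
  InC-∙ {b} {c} {x} {a} {y} x∈ y∈ = begin
    (x ∙ y) ∙ a  ≈⟨ assoc x y a ⟩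
    x ∙ (y ∙ a)  ≈⟨ ∙-congˡ y∈ ⟩
    x ∙ (b ∙ y)  ≈⟨ sym (assoc x b y) ⟩
    (x ∙ b) ∙ y  ≈⟨ ∙-congʳ x∈ ⟩
    (c ∙ x) ∙ y  ≈⟨ assoc c x y ⟩
    c ∙ (x ∙ y)  ∎

  InC-inverse : InC a b p → IsInverse p q → InC b a q
  InC-inverse {a} {b} {p} {q} p∈ (pq , qp) = begin
    q ∙ b              ≈⟨ insertʳ pq (q ∙ b) ⟩
    ((q ∙ b) ∙ p) ∙ q  ≈⟨ ∙-congʳ (assoc q b p) ⟩
    (q ∙ (b ∙ p)) ∙ q  ≈⟨ ∙-congʳ (∙-congˡ (sym p∈)) ⟩
    (q ∙ (p ∙ a)) ∙ q  ≈⟨ ∙-congʳ (cancelˡ qp a) ⟩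
    a ∙ q              ∎

  conjugate⇒InC : IsInverse p q → b ≈ p ∙ a ∙ q → InC a b p
  conjugate⇒InC {p} {q} {a = a} (_ , qp) b≈pAq =
    trans (insertʳ qp (p ∙ a)) (∙-congʳ (sym b≈pAq))

  InC⇒conjugate : InC a b p → IsInverse p q → b ≈ p ∙ a ∙ q
  InC⇒conjugate {b = b} {q = q} p∈ (pq , _) =
    trans (insertʳ pq b) (∙-congʳ (sym p∈))

  invertible⇒IsFreeGenerator : InC a b p → IsInverse p q → IsFreeGenerator a b p
  invertible⇒IsFreeGenerator {p = p} {q} p∈ (pq , qp) = p∈ , span , injective
    where
    span : ∀ x → InC _ _ x → ∃ λ y → InC _ _ y × (x ≈ y ∙ p)
    span x x∈ = x ∙ q , InC-∙ x∈ (InC-inverse p∈ (pq , qp)) , insertʳ qp x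

    injective : ∀ y y′ → InC _ _ y → InC _ _ y′ → y ∙ p ≈ y′ ∙ p → y ≈ y′
    injective y y′ _ _ yp≈y′p = begin
      y            ≈⟨ insertʳ pq y ⟩
      (y ∙ p) ∙ q  ≈⟨ ∙-congʳ yp≈y′p ⟩
      (y′ ∙ p) ∙ q ≈⟨ cancelʳ pq y′ ⟩
      y′           ∎

  freeGenerators-associated : IsFreeGenerator a b c → IsFreeGenerator a b c′ →
                              ∃ λ u → ∃ λ v → IsInverse u v × (c ≈ u ∙ c′)
  freeGenerators-associated {c = c} {c′ = c′} (c∈ , spanᶜ , injᶜ) (c′∈ , spanᶜ′ , injᶜ′)
    with spanᶜ′ c c∈ | spanᶜ c′ c′∈
  ... | u , u∈ , c≈uc′ | v , v∈ , c′≈vc =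
    u , v , ( injᶜ  (u ∙ v) ε (InC-∙ u∈ v∈) InC-ε (collapse c≈uc′ c′≈vc)
            , injᶜ′ (v ∙ u) ε (InC-∙ v∈ u∈) InC-ε (collapse c′≈vc c≈uc′))
      , c≈uc′
    where
    collapse : ∀ {s t x y} → x ≈ s ∙ y → y ≈ t ∙ x → (s ∙ t) ∙ x ≈ ε ∙ x
    collapse {s} {t} {x} {y} x≈sy y≈tx = begin
      (s ∙ t) ∙ x  ≈⟨ assoc s t x ⟩
      s ∙ (t ∙ x)  ≈⟨ ∙-congˡ (sym y≈tx) ⟩
      s ∙ y        ≈⟨ sym x≈sy ⟩
      x            ≈⟨ sym (identityˡ x) ⟩
      ε ∙ x        ∎

  similar⇒IsFreeGenerator⇒InGL : Similar a b → IsFreeGenerator a b c → InGL c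
  similar⇒IsFreeGenerator⇒InGL (p , q , pq-inv , b≈pAq) c-gen
    with freeGenerators-associated c-gen
           (invertible⇒IsFreeGenerator (conjugate⇒InC pq-inv b≈pAq) pq-inv)
  ... | u , v , uv-inv , c≈up = q ∙ v , IsInverse-respˡ (sym c≈up) (IsInverse-∙ uv-inv pq-inv)

  similar⇔freeRank1×generatorsInGL :
    Similar a b ⇔ (FreeRank1 a b × (∀ c → IsFreeGenerator a b c → InGL c))
  similar⇔freeRank1×generatorsInGL = mk⇔ to from
    where
    to : Similar a b → FreeRank1 a b × (∀ c → IsFreeGenerator a b c → InGL c)
    to sim@(p , q , pq-inv , b≈pAq) =
        (p , invertible⇒IsFreeGenerator (conjugate⇒InC pq-inv b≈pAq) pq-inv)
      , λ _ → similar⇒IsFreeGenerator⇒InGL sim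

    from : FreeRank1 a b × (∀ c → IsFreeGenerator a b c → InGL c) → Similar a b
    from ((c , c-gen) , generatorsInGL) with generatorsInGL c c-gen
    ... | d , cd-inv = c , d , cd-inv , InC⇒conjugate (proj₁ c-gen) cd-inv

module Matrices {c ℓ} (R : CommutativeRing c ℓ) where
  open CommutativeRing R
  open MatrixDefs R
  open SemiringSum semiring
    using (sum; sum-cong-≋; sum-replicate-zero; ∑-comm; *-distribˡ-sum; *-distribʳ-sum)

  sum-zero : ∀ {k} (v : Fin k → Carrier) → (∀ i → v i ≈ 0#) → sum v ≈ 0#
  sum-zero {k} v v≈0 = trans (sum-cong-≋ v≈0) (sum-replicate-zero k)

  sum-Iᴹ-* : ∀ {k} (i : Fin k) (v : Fin k → Carrier) → sum (λ j → Iᴹ i j * v j) ≈ v i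
  sum-Iᴹ-* zero v =
    trans (+-cong (*-identityˡ _) (sum-zero _ (λ j → zeroˡ (v (suc j))))) (+-identityʳ _)
  sum-Iᴹ-* (suc i) v = trans (+-cong (zeroˡ _) (sum-Iᴹ-* i (λ j → v (suc j)))) (+-identityˡ _)

  sum-*-Iᴹ : ∀ {k} (i : Fin k) (v : Fin k → Carrier) → sum (λ j → v j * Iᴹ j i) ≈ v i
  sum-*-Iᴹ zero v =
    trans (+-cong (*-identityʳ _) (sum-zero _ (λ j → zeroʳ (v (suc j))))) (+-identityʳ _)
  sum-*-Iᴹ (suc i) v = trans (+-cong (zeroʳ _) (sum-*-Iᴹ i (λ j → v (suc j)))) (+-identityˡ _)

  module _ {n : ℕ} where
    *ᴹ-identityˡ : (X : Mat n) → Iᴹ *ᴹ X ≈ᴹ X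
    *ᴹ-identityˡ X i j = sum-Iᴹ-* i (λ k → X k j)

    *ᴹ-identityʳ : (X : Mat n) → X *ᴹ Iᴹ ≈ᴹ X
    *ᴹ-identityʳ X i j = sum-*-Iᴹ j (X i)

    *ᴹ-cong : {X X′ Y Y′ : Mat n} → X ≈ᴹ X′ → Y ≈ᴹ Y′ → X *ᴹ Y ≈ᴹ X′ *ᴹ Y′
    *ᴹ-cong X≈X′ Y≈Y′ i j = sum-cong-≋ (λ k → *-cong (X≈X′ i k) (Y≈Y′ k j))

    *ᴹ-assoc : (X Y Z : Mat n) → (X *ᴹ Y) *ᴹ Z ≈ᴹ X *ᴹ (Y *ᴹ Z)
    *ᴹ-assoc X Y Z i j = begin
      sum (λ k → sum (λ l → X i l * Y l k) * Z k j)
        ≈⟨ sum-cong-≋ (λ k → *-distribʳ-sum (Z k j) (λ l → X i l * Y l k)) ⟩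
      sum (λ k → sum (λ l → X i l * Y l k * Z k j))
        ≈⟨ ∑-comm (λ k l → X i l * Y l k * Z k j) ⟩
      sum (λ l → sum (λ k → X i l * Y l k * Z k j))
        ≈⟨ sum-cong-≋ (λ l → sum-cong-≋ (λ k → *-assoc (X i l) (Y l k) (Z k j))) ⟩
      sum (λ l → sum (λ k → X i l * (Y l k * Z k j)))
        ≈⟨ sum-cong-≋ (λ l → sym (*-distribˡ-sum (X i l) (λ k → Y l k * Z k j))) ⟩
      sum (λ l → X i l * sum (λ k → Y l k * Z k j))
        ∎
      where open SetoidReasoning setoid

  *ᴹ-monoid : ℕ → Monoid c ℓ
  *ᴹ-monoid n = record
    { Carrier  = Mat n
    ; _≈_      = _≈ᴹ_
    ; _∙_      = _*ᴹ_
    ; ε        = Iᴹ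
    ; isMonoid = record
      { isSemigroup = record
        { isMagma = record
          { isEquivalence = record
            { refl  = λ _ _ → refl
            ; sym   = λ X≈Y i j → sym (X≈Y i j)
            ; trans = λ X≈Y Y≈Z i j → trans (X≈Y i j) (Y≈Z i j)
            }
          ; ∙-cong = *ᴹ-cong
          }
        ; assoc = *ᴹ-assoc
        }
      ; identity = *ᴹ-identityˡ , *ᴹ-identityʳ
      }
    }

proposition9p2 : ∀ {c ℓ : Level} (R : CommutativeRing c ℓ) (n : ℕ) → 0 < n →
    let open MatrixDefs R in
    (A B : Mat n) →
    (Similar A B ⇔ (FreeRank1 A B × (∀ C → IsFreeGenerator A B C → InGL C)))
    × (Similar A B → ∀ C D → IsFreeGenerator A B C → IsInverse C D → B ≈ᴹ C *ᴹ A *ᴹ D)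
proposition9p2 R n _ A B =
    similar⇔freeRank1×generatorsInGL
  , λ _ C D C-gen CD-inv → InC⇒conjugate (proj₁ C-gen) CD-inv
  where open Intertwining (Matrices.*ᴹ-monoid R n)
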